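{- Let $D$ be a finite acyclic digraph (one containing no directed cycle). Then $D$ is $k$-AW for all integers $k\ge 2$.
   Context: The $k$-lights out game on a digraph $D$: start with a labeling $\lambda:V(D)\to\mathbb{Z}_k$. Toggling a vertex $v$ increases by $1$ (mod $k$) the label of $v$ and of every vertex $w$ with $vw\in A(D)$ (i.e. every vertex $v$ dominates). The game is won when every vertex has label $0$. A labeling is $k$-winnable if some sequence of toggles wins the game from it. $D$ is $k$-Always Winnable ($k$-AW) if every labeling $V(D)\to\mathbb{Z}_k$ is $k$-winnable. -}

module Defs where

open import Data.Nat using (ℕ; suc; NonZero)
open import Data.Nat.DivMod using (_mod_)
open import Data.Fin using (Fin; toℕ; _≟_)
open import Data.Bool using (Bool; true; false; if_then_else_; _∨_)
open import Data.List using (List; foldl)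
open import Relation.Nullary.Decidable using (⌊_⌋)
open import Relation.Nullary using (¬_)
open import Data.Product using (∃)
open import Relation.Binary.PropositionalEquality using (_≡_)
open import Relation.Binary.Construct.Closure.Transitive using (TransClosure)

record Digraph : Set where
  field
    n   : ℕ
    arc : Fin n → Fin n → Bool

open Digraph public

Arc : (D : Digraph) → Fin (n D) → Fin (n D) → Set
Arc D v w = arc D v w ≡ true

-- D contains no directed cycle: no vertex reaches itself by a nonempty
-- directed walk (this includes loops, i.e. cycles of length 1).
Acyclic : Digraph → Set
Acyclic D = ∀ v → ¬ TransClosure (Arc D) v v

-- Labelings V(D) → ℤ_k, with ℤ_k represented by Fin k.
Labeling : Digraph → (k : ℕ) → Set
Labeling D k = Fin (n D) → Fin k

inc : {k : ℕ} .{{_ : NonZero k}} → Fin k → Fin k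
inc {k} x = suc (toℕ x) mod k

toggle : (D : Digraph) {k : ℕ} .{{_ : NonZero k}} →
         Fin (n D) → Labeling D k → Labeling D k
toggle D v λ′ w =
  if ⌊ v ≟ w ⌋ ∨ arc D v w then inc (λ′ w) else λ′ w

play : (D : Digraph) {k : ℕ} .{{_ : NonZero k}} →
       List (Fin (n D)) → Labeling D k → Labeling D k
play D vs λ₀ = foldl (λ λ′ v → toggle D v λ′) λ₀ vs

zeroLab : (D : Digraph) {k : ℕ} .{{_ : NonZero k}} → Labeling D k
zeroLab D {k} _ = 0 mod k

Winnable : (D : Digraph) (k : ℕ) .{{_ : NonZero k}} → Labeling D k → Set
Winnable D k λ₀ = ∃ λ (vs : List (Fin (n D))) → ∀ w → play D vs λ₀ w ≡ zeroLab D w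

AlwaysWinnable : (D : Digraph) (k : ℕ) .{{_ : NonZero k}} → Set
AlwaysWinnable D k = ∀ (λ₀ : Labeling D k) → Winnable D k λ₀

{-# OPTIONS --safe #-}
-- Keep a set U of vertices, closed under out-neighbours, outside of which every
-- label is already 0.  As D is acyclic, a nonempty U has a source s (no
-- in-neighbour in U): otherwise one could walk backwards inside U forever, and by
-- pigeonhole the walk would close a cycle.  Toggling s exactly k − λ(s) times
-- zeroes its label and changes only s and its out-neighbours, which lie in U; so
-- U − s again satisfies the invariant, and we recurse until U is empty.
module Submission where

open import Defs
open import Data.Nat using (ℕ; zero; suc; _+_; _∸_; _≤_; _<_; NonZero; >-nonZero; s≤s; z≤n)
open import Data.Nat.Properties using (≤-trans; +-identityʳ; +-suc; m+[n∸m]≡n; <⇒≤; m≤n⇒m<n∨m≡n; n<1+n)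
open import Data.Nat.DivMod using (_mod_; _%_; %-distribˡ-+; m%n%n≡m%n; [m+n]%n≡m%n; m<n⇒m%n≡m)
open import Data.Nat.GeneralisedArithmetic using (iterate)
open import Data.Nat.Induction using (<-wellFounded)
open import Induction.WellFounded using (Acc; acc)
open import Data.Fin using (Fin; toℕ; _≟_)
open import Data.Fin.Properties using (toℕ-injective; toℕ-fromℕ<; toℕ<n; all?; any?; ¬∀⟶∃¬; pigeonhole)
open import Data.Fin.Subset using (Subset; _∈_; _∉_; _-_; ⁅_⁆; ∣_∣; ⊤)
open import Data.Fin.Subset.Properties using (_∈?_; nonempty?; ∈⊤; x∈p⇒∣p-x∣<∣p∣; x∈p∧x≢y⇒x∈p-y; p─q⊆p)
open import Data.Bool using (true; false)
open import Data.Bool.Properties using (¬-not) renaming (_≟_ to _≟ᵇ_)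
open import Data.List using (List; []; _++_; replicate)
open import Data.List.Properties using (foldl-++)
open import Data.Product using (∃; Σ; _×_; _,_; proj₁; proj₂)
open import Data.Sum using (inj₁; inj₂)
open import Data.Empty using (⊥-elim)
open import Relation.Nullary using (¬_; Dec; yes; no)
open import Relation.Nullary.Decidable using (decidable-stable; _×-dec_; _→-dec_; ¬?)
open import Relation.Binary.PropositionalEquality
  using (_≡_; _≢_; refl; sym; trans; cong; cong-app; subst; module ≡-Reasoning)
open import Relation.Binary.Construct.Closure.Transitive using (TransClosure; [_]; _∷_)

chain⇒TransClosure : ∀ {a r} {A : Set a} {R : A → A → Set r} (f : ℕ → A) →
                     (∀ i → R (f (suc i)) (f i)) →
                     ∀ {i j} → i < j → TransClosure R (f j) (f i)
chain⇒TransClosure f step {i} {suc j} (s≤s i≤j) with m≤n⇒m<n∨m≡n i≤j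
... | inj₁ i<j  = step j ∷ chain⇒TransClosure f step i<j
... | inj₂ refl = [ step i ]

[m%d+n]%d≡[m+n]%d : ∀ m n d .{{_ : NonZero d}} → (m % d + n) % d ≡ (m + n) % d
[m%d+n]%d≡[m+n]%d m n d = begin
  (m % d + n) % d            ≡⟨ %-distribˡ-+ (m % d) n d ⟩
  (m % d % d + n % d) % d    ≡⟨ cong (λ x → (x + n % d) % d) (m%n%n≡m%n m d) ⟩
  (m % d + n % d) % d        ≡⟨ %-distribˡ-+ m n d ⟨
  (m + n) % d                ∎
  where open ≡-Reasoning

module _ {k : ℕ} .{{_ : NonZero k}} where

  toℕ-iterate-inc : ∀ (x : Fin k) j → toℕ (iterate inc x j) ≡ (toℕ x + j) % k
  toℕ-iterate-inc x zero = sym (trans (cong (_% k) (+-identityʳ (toℕ x))) (m<n⇒m%n≡m (toℕ<n x)))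
  toℕ-iterate-inc x (suc j) = begin
    toℕ (iterate inc (inc x) j)   ≡⟨ toℕ-iterate-inc (inc x) j ⟩
    (toℕ (inc x) + j) % k         ≡⟨ cong (λ y → (y + j) % k) (toℕ-fromℕ< _) ⟩
    (suc (toℕ x) % k + j) % k     ≡⟨ [m%d+n]%d≡[m+n]%d (suc (toℕ x)) j k ⟩
    (suc (toℕ x) + j) % k         ≡⟨ cong (_% k) (+-suc (toℕ x) j) ⟨
    (toℕ x + suc j) % k           ∎
    where open ≡-Reasoning

  iterate-inc-[k∸x]≡0 : ∀ (x : Fin k) → iterate inc x (k ∸ toℕ x) ≡ 0 mod k
  iterate-inc-[k∸x]≡0 x = toℕ-injective (begin
    toℕ (iterate inc x (k ∸ toℕ x))  ≡⟨ toℕ-iterate-inc x (k ∸ toℕ x) ⟩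
    (toℕ x + (k ∸ toℕ x)) % k        ≡⟨ cong (_% k) (m+[n∸m]≡n (<⇒≤ (toℕ<n x))) ⟩
    k % k                            ≡⟨ [m+n]%n≡m%n 0 k ⟩
    0 % k                            ≡⟨ toℕ-fromℕ< _ ⟨
    toℕ (0 mod k)                    ∎)
    where open ≡-Reasoning

module _ (D : Digraph) where

  private
    V = Fin (n D)

  module _ {k : ℕ} .{{_ : NonZero k}} where

    toggle-self : ∀ v (l : Labeling D k) → toggle D v l v ≡ inc (l v)
    toggle-self v l with v ≟ v
    ... | yes _   = refl
    ... | no v≢v = ⊥-elim (v≢v refl)

    toggle-unaffected : ∀ {v w} (l : Labeling D k) → v ≢ w → arc D v w ≡ false →
                        toggle D v l w ≡ l w
    toggle-unaffected {v} {w} l v≢w v↛w with v ≟ w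
    ... | yes v≡w = ⊥-elim (v≢w v≡w)
    ... | no _ rewrite v↛w = refl

    play-++ : ∀ us vs (l : Labeling D k) → play D (us ++ vs) l ≡ play D vs (play D us l)
    play-++ us vs l = foldl-++ (λ l′ v → toggle D v l′) l us vs

    play-replicate-self : ∀ t v (l : Labeling D k) →
                          play D (replicate t v) l v ≡ iterate inc (l v) t
    play-replicate-self zero    v l = refl
    play-replicate-self (suc t) v l =
      trans (play-replicate-self t v (toggle D v l)) (cong (λ x → iterate inc x t) (toggle-self v l))

    play-replicate-unaffected : ∀ t {v w} (l : Labeling D k) → v ≢ w → arc D v w ≡ false →
                                play D (replicate t v) l w ≡ l w
    play-replicate-unaffected zero    l v≢w v↛w = refl
    play-replicate-unaffected (suc t) l v≢w v↛w =
      trans (play-replicate-unaffected t (toggle D _ l) v≢w v↛w) (toggle-unaffected l v≢w v↛w)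

  arc? : ∀ u v → Dec (Arc D u v)
  arc? u v = arc D u v ≟ᵇ true

  IsSource : Subset (n D) → V → Set
  IsSource U s = s ∈ U × (∀ u → u ∈ U → ¬ Arc D u s)

  isSource? : ∀ U s → Dec (IsSource U s)
  isSource? U s = (s ∈? U) ×-dec all? (λ u → (u ∈? U) →-dec ¬? (arc? u s))

  in-neighbour-of-non-source : ∀ {U w} → w ∈ U → ¬ IsSource U w →
                               ∃ λ u → u ∈ U × Arc D u w
  in-neighbour-of-non-source {U} {w} w∈U ¬source
    with ¬∀⟶∃¬ (n D) _ (λ u → (u ∈? U) →-dec ¬? (arc? u w)) (λ h → ¬source (w∈U , h))
  ... | u , ¬[u∈U→u↛w] =
    u , decidable-stable ((u ∈? U) ×-dec arc? u w) (λ ¬both → ¬[u∈U→u↛w] (λ u∈U uw → ¬both (u∈U , uw)))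

  no-infinite-descent : Acyclic D → (f : ℕ → V) → ¬ (∀ i → Arc D (f (suc i)) (f i))
  no-infinite-descent acyclic f step with pigeonhole (n<1+n (n D)) (λ i → f (toℕ i))
  ... | i , j , i<j , fi≡fj =
    acyclic (f (toℕ i)) (subst (λ x → TransClosure (Arc D) x (f (toℕ i))) (sym fi≡fj)
                                (chain⇒TransClosure f step i<j))

  source-exists : Acyclic D → ∀ {U v} → v ∈ U → ∃ (IsSource U)
  source-exists acyclic {U} {v} v∈U with any? (isSource? U)
  ... | yes source = source
  ... | no ¬source = ⊥-elim (no-infinite-descent acyclic (λ i → proj₁ (descend i))
                              (λ i → proj₂ (proj₂ (predecessor (descend i)))))
    where
    predecessor : (w : Σ V (_∈ U)) → ∃ λ u → u ∈ U × Arc D u (proj₁ w)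
    predecessor (w , w∈U) = in-neighbour-of-non-source w∈U (λ s → ¬source (w , s))

    descend : ℕ → Σ V (_∈ U)
    descend zero    = v , v∈U
    descend (suc i) = let u , u∈U , _ = predecessor (descend i) in u , u∈U

  UpClosed : Subset (n D) → Set
  UpClosed U = ∀ {v w} → v ∈ U → Arc D v w → w ∈ U

  UpClosed-remove-source : ∀ {U s} → UpClosed U → IsSource U s → UpClosed (U - s)
  UpClosed-remove-source {U} {s} closed (_ , no-arc-into-s) {v} {w} v∈U-s vw =
    x∈p∧x≢y⇒x∈p-y (closed v∈U vw) (λ { refl → no-arc-into-s v v∈U vw })
    where
    v∈U : v ∈ U
    v∈U = p─q⊆p U ⁅ s ⁆ v∈U-s

  module _ {k : ℕ} .{{_ : NonZero k}} where

    ZeroOutside : Subset (n D) → Labeling D k → Set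
    ZeroOutside U l = ∀ w → w ∉ U → l w ≡ zeroLab D w

    clearing : V → Labeling D k → List V
    clearing v l = replicate (k ∸ toℕ (l v)) v

    ZeroOutside-clear-source : ∀ {U s l} → UpClosed U → s ∈ U → ZeroOutside U l →
                               ZeroOutside (U - s) (play D (clearing s l) l)
    ZeroOutside-clear-source {U} {s} {l} closed s∈U zero-outside w w∉U-s with w ≟ s
    ... | yes refl = trans (play-replicate-self (k ∸ toℕ (l w)) w l) (iterate-inc-[k∸x]≡0 (l w))
    ... | no w≢s   =
      trans (play-replicate-unaffected (k ∸ toℕ (l s)) l (λ s≡w → w≢s (sym s≡w)) s↛w) (zero-outside w w∉U)
      where
      w∉U : w ∉ U
      w∉U w∈U = w∉U-s (x∈p∧x≢y⇒x∈p-y w∈U w≢s)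

      s↛w : arc D s w ≡ false
      s↛w = ¬-not (λ sw → w∉U (closed s∈U sw))

    winnable-if-ZeroOutside : Acyclic D → ∀ U → Acc _<_ ∣ U ∣ → UpClosed U →
                              ∀ l → ZeroOutside U l → Winnable D k l
    winnable-if-ZeroOutside acyclic U (acc smaller) closed l zero-outside with nonempty? U
    ... | no empty = [] , λ w → zero-outside w (λ w∈U → empty (w , w∈U))
    ... | yes (_ , v∈U) with source-exists acyclic v∈U
    ... | s , source@(s∈U , _)
      with winnable-if-ZeroOutside acyclic (U - s) (smaller (x∈p⇒∣p-x∣<∣p∣ s∈U))
             (UpClosed-remove-source closed source) (play D (clearing s l) l)
             (ZeroOutside-clear-source closed s∈U zero-outside)
    ... | vs , wins = clearing s l ++ vs , λ w → trans (cong-app (play-++ (clearing s l) vs l) w) (wins w)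

  acyclic⇒AlwaysWinnable : Acyclic D → ∀ k .{{_ : NonZero k}} → AlwaysWinnable D k
  acyclic⇒AlwaysWinnable acyclic k l =
    winnable-if-ZeroOutside acyclic ⊤ (<-wellFounded _) (λ _ _ → ∈⊤) l (λ w w∉⊤ → ⊥-elim (w∉⊤ ∈⊤))

mainTheorem2 : (D : Digraph) → Acyclic D →
    (k : ℕ) → (2≤k : 2 ≤ k) → AlwaysWinnable D k {{>-nonZero (≤-trans (s≤s z≤n) 2≤k)}}
mainTheorem2 D acyclic k 2≤k = acyclic⇒AlwaysWinnable D acyclic k {{>-nonZero (≤-trans (s≤s z≤n) 2≤k)}}
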